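{- Let $\Upsilon_1,\Upsilon_2$ be sets of positions with $\mathcal{M}_{\mathrm{cl}(\Upsilon_1)}\cong\mathcal{M}_{\mathrm{cl}(\Upsilon_2)}\cong\mathcal{M}_{\mathrm{cl}(*)}$, let $\mathscr{Q}_k:\mathrm{cl}(\Upsilon_k)\to\mathcal{M}_{\mathrm{cl}(\Upsilon_k)}$ ($k=1,2$) be the canonical quotient maps and $\varphi_k:\mathcal{M}_{\mathrm{cl}(\Upsilon_k)}\to\mathcal{M}_{\mathrm{cl}(*)}$ misère monoid isomorphisms. Then for all $\xi_1\in\mathrm{cl}(\Upsilon_1)$, $\xi_2\in\mathrm{cl}(\Upsilon_2)$: (1) $o^-(\xi_1+\xi_2)\in\{\mathcal{N},\mathcal{P}\}$; (2) $o^-(\xi_1+\xi_2)=o^-\big(\varphi_1(\mathscr{Q}_1(\xi_1))\cdot\varphi_2(\mathscr{Q}_2(\xi_2))\big)$, where $\cdot$ is the operation of $\mathcal{M}_{\mathrm{cl}(*)}$ and $o^-$ of an element of $\mathcal{M}_{\mathrm{cl}(*)}$ is its outcome label.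
   Context: A position $\xi=\{\xi^L \mid \xi^R\}$ is given recursively by finite sets of Left and Right options. $0=\{\cdot\mid\cdot\}$, $*=\{0\mid 0\}$. Disjunctive sum: $\alpha+\beta=\{\alpha^L+\beta,\alpha+\beta^L \mid \alpha^R+\beta,\alpha+\beta^R\}$. Under misère play a player unable to move on their turn wins; $o^-(\xi)\in\{\mathcal{L},\mathcal{R},\mathcal{N},\mathcal{P}\}$ is the misère outcome (Left wins always / Right wins always / next player wins / next player loses). $\mathrm{cl}(\Upsilon)$ is the smallest set containing $\Upsilon$ closed under disjunctive sum and taking options. For closed $\Gamma$, $\alpha\equiv\beta\pmod\Gamma$ iff $o^-(\alpha+\gamma)=o^-(\beta+\gamma)$ for all $\gamma\in\Gamma$; the misère monoid $\mathcal{M}_\Gamma$ is the quotient monoid (operation induced by $+$, identity the class of $0$) with each class labelled by its members' misère outcome; the canonical quotient map sends a position to its class. Isomorphism of misère monoids means a monoid isomorphism which with its inverse preserves outcomes. $\mathcal{M}_{\mathrm{cl}(*)}=\{1,a\}$, $a^2=1$, $1$ of outcome $\mathcal{N}$, $a$ of outcome $\mathcal{P}$. -}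

module Defs where

open import Data.List using (List; []; _∷_; _++_)
open import Data.List.Membership.Propositional using (_∈_)
open import Data.Bool using (Bool; true; false; not; _∨_)
open import Data.Product using (Σ; ∃; _×_; _,_; proj₁)
open import Relation.Binary.PropositionalEquality using (_≡_)

data Game : Set where
  ⟨_∣_⟩ : List Game → List Game → Game

zeroG : Game
zeroG = ⟨ [] ∣ [] ⟩

star : Game
star = ⟨ zeroG ∷ [] ∣ zeroG ∷ [] ⟩

mutual
  infixl 6 _⊕_
  _⊕_ : Game → Game → Game
  ⟨ L ∣ R ⟩ ⊕ ⟨ L' ∣ R' ⟩ =
    ⟨ sumˡ L ⟨ L' ∣ R' ⟩ ++ sumʳ ⟨ L ∣ R ⟩ L'
    ∣ sumˡ R ⟨ L' ∣ R' ⟩ ++ sumʳ ⟨ L ∣ R ⟩ R' ⟩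

  sumˡ : List Game → Game → List Game
  sumˡ [] h = []
  sumˡ (a ∷ as) h = (a ⊕ h) ∷ sumˡ as h

  sumʳ : Game → List Game → List Game
  sumʳ g [] = []
  sumʳ g (b ∷ bs) = (g ⊕ b) ∷ sumʳ g bs

-- Misère play: leftFirst g = true iff Left, moving first, wins g;
-- rightFirst g = true iff Right, moving first, wins g.
-- A player with no move on their turn wins.
mutual
  leftFirst : Game → Bool
  leftFirst ⟨ [] ∣ R ⟩ = true
  leftFirst ⟨ x ∷ xs ∣ R ⟩ = someRightFirstLoses (x ∷ xs)

  rightFirst : Game → Bool
  rightFirst ⟨ L ∣ [] ⟩ = true
  rightFirst ⟨ L ∣ y ∷ ys ⟩ = someLeftFirstLoses (y ∷ ys)

  someRightFirstLoses : List Game → Bool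
  someRightFirstLoses [] = false
  someRightFirstLoses (g ∷ gs) = not (rightFirst g) ∨ someRightFirstLoses gs

  someLeftFirstLoses : List Game → Bool
  someLeftFirstLoses [] = false
  someLeftFirstLoses (g ∷ gs) = not (leftFirst g) ∨ someLeftFirstLoses gs

data Outcome : Set where
  𝓛 𝓡 𝓝 𝓟 : Outcome

outcomeOf : Bool → Bool → Outcome
outcomeOf true  false = 𝓛
outcomeOf false true  = 𝓡
outcomeOf true  true  = 𝓝
outcomeOf false false = 𝓟

o⁻ : Game → Outcome
o⁻ g = outcomeOf (leftFirst g) (rightFirst g)

data Cl (Υ : Game → Set) : Game → Set where
  base : ∀ {g} → Υ g → Cl Υ g
  sum  : ∀ {g h} → Cl Υ g → Cl Υ h → Cl Υ (g ⊕ h)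
  optL : ∀ {L R g} → Cl Υ ⟨ L ∣ R ⟩ → g ∈ L → Cl Υ g
  optR : ∀ {L R g} → Cl Υ ⟨ L ∣ R ⟩ → g ∈ R → Cl Υ g

_≡[_]_ : Game → (Game → Set) → Game → Set
α ≡[ Γ ] β = ∀ γ → Γ γ → o⁻ (α ⊕ γ) ≡ o⁻ (β ⊕ γ)

IsStar : Game → Set
IsStar g = g ≡ star

-- Elements of cl(Υ); the misère monoid M_cl(Υ) is this type modulo
-- _≡[ Cl Υ ]_ (a setoid quotient), with product induced by ⊕, identity the
-- class of 0, and each class labelled by o⁻ of its members.  The canonical
-- quotient map 𝒬 is the identity on representatives.
ClElem : (Game → Set) → Set
ClElem Υ = Σ Game (Cl Υ)

-- A misère monoid isomorphism φ : M_cl(Υ) → M_cl(Δ), given on representatives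
-- (so φ ∘ 𝒬 : cl(Υ) → cl(Δ) choosing a representative of the image class).
record MisereIso (Υ Δ : Game → Set) : Set where
  field
    map       : ClElem Υ → ClElem Δ
    respects  : ∀ (x y : ClElem Υ) → proj₁ x ≡[ Cl Υ ] proj₁ y
                      → proj₁ (map x) ≡[ Cl Δ ] proj₁ (map y)
    injective : ∀ (x y : ClElem Υ) → proj₁ (map x) ≡[ Cl Δ ] proj₁ (map y)
                      → proj₁ x ≡[ Cl Υ ] proj₁ y
    surjective : ∀ (y : ClElem Δ) → ∃ λ (x : ClElem Υ) → proj₁ (map x) ≡[ Cl Δ ] proj₁ y
    homo      : ∀ g (cg : Cl Υ g) h (ch : Cl Υ h)
                → proj₁ (map (g ⊕ h , sum cg ch))
                    ≡[ Cl Δ ] (proj₁ (map (g , cg)) ⊕ proj₁ (map (h , ch)))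
    identity  : ∀ (x : ClElem Υ) → proj₁ x ≡[ Cl Υ ] zeroG → proj₁ (map x) ≡[ Cl Δ ] zeroG
    -- preserves outcome labels (hence so does the inverse, being bijective)
    outcome   : ∀ (x : ClElem Υ) → o⁻ (proj₁ (map x)) ≡ o⁻ (proj₁ x)

open MisereIso public

module Submission where

-- Call a position g *uniform of parity p* (p = true meaning
-- "odd") when whoever moves first in g wins exactly if p is even, and every
-- option of g is uniform of the opposite parity.  Uniform positions behave
-- like sums of copies of * taken mod 2:
--   * parities add under disjunctive sum (xor), and 0, * are uniform of
--     parities even, odd; hence every position of cl(*) is uniform;
--   * the outcome of a uniform position of parity p is 𝓝 (p even) or 𝓟
--     (p odd).
-- Given an isomorphism φ : M_cl(Υ) ≅ M_cl(*), give each ξ ∈ cl(Υ) the parity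
-- of its image.  Because φ preserves outcomes and products, this parity
-- predicts the outcome of ξ and is additive; using a preimage of * one sees
-- that it flips along every option, since a 𝓟-position has no 𝓟-option.
-- A general lemma then shows that every position of cl(Υ) is uniform of its
-- parity.  The theorem follows: ξ₁ ⊕ ξ₂ and φ₁(ξ₁) ⊕ φ₂(ξ₂) are both uniform
-- of parity p₁ xor p₂, so they share the outcome, which is 𝓝 or 𝓟.

open import Defs
open import Data.Product using (_×_; _,_; proj₁)
open import Data.Sum using (_⊎_)
open import Relation.Binary.PropositionalEquality using (_≡_)

open import Data.Bool using (Bool; true; false; not; _xor_)
open import Data.Bool.Properties
  using (∨-conicalˡ; ∨-conicalʳ; not-injective; ¬-not; not-¬; not-distribˡ-xor; not-distribʳ-xor; xor-identityʳ)
open import Data.List using ([]; _∷_; _++_) renaming (map to mapList)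
open import Data.List.Membership.Propositional using (_∈_)
open import Data.List.Membership.Propositional.Properties
  using (∈-++⁺ˡ; ∈-++⁺ʳ; ∈-++⁻; ∈-map⁺; ∈-map⁻)
open import Data.List.Relation.Unary.Any using (here; there)
open import Data.Product using (Σ; ∃; proj₂)
open import Data.Sum using (inj₁; inj₂) renaming (map to ⊎-map)
open import Relation.Binary.PropositionalEquality
  using (_≢_; refl; sym; trans; cong; cong₂; subst; module ≡-Reasoning)

_∈ᴼ_ : Game → Game → Set
x ∈ᴼ ⟨ L ∣ R ⟩ = x ∈ L ⊎ x ∈ R

sumˡ≡map : ∀ A h → sumˡ A h ≡ mapList (_⊕ h) A
sumˡ≡map []      h = refl
sumˡ≡map (x ∷ A) h = cong ((x ⊕ h) ∷_) (sumˡ≡map A h)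

sumʳ≡map : ∀ g B → sumʳ g B ≡ mapList (g ⊕_) B
sumʳ≡map g []      = refl
sumʳ≡map g (y ∷ B) = cong ((g ⊕ y) ∷_) (sumʳ≡map g B)

sum-optionˡ : ∀ {x} A B g h → x ∈ A → (x ⊕ h) ∈ sumˡ A h ++ sumʳ g B
sum-optionˡ A B g h m rewrite sumˡ≡map A h = ∈-++⁺ˡ (∈-map⁺ (_⊕ h) m)

sum-optionʳ : ∀ {y} A B g h → y ∈ B → (g ⊕ y) ∈ sumˡ A h ++ sumʳ g B
sum-optionʳ A B g h m rewrite sumʳ≡map g B = ∈-++⁺ʳ (sumˡ A h) (∈-map⁺ (g ⊕_) m)

sum-option⁻ : ∀ {z} A B g h → z ∈ sumˡ A h ++ sumʳ g B
            → (∃ λ x → x ∈ A × z ≡ x ⊕ h) ⊎ (∃ λ y → y ∈ B × z ≡ g ⊕ y)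
sum-option⁻ A B g h m rewrite sumˡ≡map A h | sumʳ≡map g B =
  ⊎-map (∈-map⁻ (_⊕ h)) (∈-map⁻ (g ⊕_)) (∈-++⁻ (mapList (_⊕ h) A) m)

sum-options-all : ∀ {P : Game → Set} {A B g h}
                → (∀ {x} → x ∈ A → P (x ⊕ h)) → (∀ {y} → y ∈ B → P (g ⊕ y))
                → ∀ {z} → z ∈ sumˡ A h ++ sumʳ g B → P z
sum-options-all {A = A} {B} {g} {h} onA onB m with sum-option⁻ A B g h m
... | inj₁ (x , x∈A , refl) = onA x∈A
... | inj₂ (y , y∈B , refl) = onB y∈B

sum-translate-option : ∀ g {ξ x} → x ∈ᴼ ξ → (g ⊕ x) ∈ᴼ (g ⊕ ξ)
sum-translate-option ⟨ A ∣ B ⟩ {⟨ L ∣ R ⟩} (inj₁ m) = inj₁ (sum-optionʳ A L ⟨ A ∣ B ⟩ ⟨ L ∣ R ⟩ m)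
sum-translate-option ⟨ A ∣ B ⟩ {⟨ L ∣ R ⟩} (inj₂ m) = inj₂ (sum-optionʳ B R ⟨ A ∣ B ⟩ ⟨ L ∣ R ⟩ m)

someRightFirstLoses-false⁺ : ∀ xs → (∀ {x} → x ∈ xs → rightFirst x ≡ true)
                           → someRightFirstLoses xs ≡ false
someRightFirstLoses-false⁺ []       _    = refl
someRightFirstLoses-false⁺ (y ∷ ys) wins rewrite wins (here refl) =
  someRightFirstLoses-false⁺ ys (λ m → wins (there m))

someRightFirstLoses-false⁻ : ∀ {x xs} → someRightFirstLoses xs ≡ false
                           → x ∈ xs → rightFirst x ≡ true
someRightFirstLoses-false⁻ {xs = y ∷ ys} e (here refl) = not-injective (∨-conicalˡ _ _ e)
someRightFirstLoses-false⁻ {xs = y ∷ ys} e (there m)   = someRightFirstLoses-false⁻ (∨-conicalʳ _ _ e) m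

someLeftFirstLoses-false⁺ : ∀ xs → (∀ {x} → x ∈ xs → leftFirst x ≡ true)
                          → someLeftFirstLoses xs ≡ false
someLeftFirstLoses-false⁺ []       _    = refl
someLeftFirstLoses-false⁺ (y ∷ ys) wins rewrite wins (here refl) =
  someLeftFirstLoses-false⁺ ys (λ m → wins (there m))

someLeftFirstLoses-false⁻ : ∀ {x xs} → someLeftFirstLoses xs ≡ false
                          → x ∈ xs → leftFirst x ≡ true
someLeftFirstLoses-false⁻ {xs = y ∷ ys} e (here refl) = not-injective (∨-conicalˡ _ _ e)
someLeftFirstLoses-false⁻ {xs = y ∷ ys} e (there m)   = someLeftFirstLoses-false⁻ (∨-conicalʳ _ _ e) m

leftFirst-true : ∀ {L R} → (∀ {x} → x ∈ L → rightFirst x ≡ false) → leftFirst ⟨ L ∣ R ⟩ ≡ true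
leftFirst-true {[]}     _     = refl
leftFirst-true {y ∷ ys} loses rewrite loses (here refl) = refl

leftFirst-false : ∀ {L R} → ∃ (_∈ L) → (∀ {x} → x ∈ L → rightFirst x ≡ true)
                → leftFirst ⟨ L ∣ R ⟩ ≡ false
leftFirst-false {[]}     (_ , ()) _
leftFirst-false {y ∷ ys} _        wins = someRightFirstLoses-false⁺ (y ∷ ys) wins

leftFirst-false⁻ : ∀ {L R x} → leftFirst ⟨ L ∣ R ⟩ ≡ false → x ∈ L → rightFirst x ≡ true
leftFirst-false⁻ {[]}     () _
leftFirst-false⁻ {y ∷ ys} e  m = someRightFirstLoses-false⁻ e m

rightFirst-true : ∀ {L R} → (∀ {x} → x ∈ R → leftFirst x ≡ false) → rightFirst ⟨ L ∣ R ⟩ ≡ true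
rightFirst-true {R = []}     _     = refl
rightFirst-true {R = y ∷ ys} loses rewrite loses (here refl) = refl

rightFirst-false : ∀ {L R} → ∃ (_∈ R) → (∀ {x} → x ∈ R → leftFirst x ≡ true)
                 → rightFirst ⟨ L ∣ R ⟩ ≡ false
rightFirst-false {R = []}     (_ , ()) _
rightFirst-false {R = y ∷ ys} _        wins = someLeftFirstLoses-false⁺ (y ∷ ys) wins

rightFirst-false⁻ : ∀ {L R x} → rightFirst ⟨ L ∣ R ⟩ ≡ false → x ∈ R → leftFirst x ≡ true
rightFirst-false⁻ {R = []}     () _
rightFirst-false⁻ {R = y ∷ ys} e  m = someLeftFirstLoses-false⁻ e m

-- The outcome label of the element of M_cl(*) of parity p: the class 1 of
-- 0 (even) has outcome 𝓝, the class a of * (odd) has outcome 𝓟.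
parityOutcome : Bool → Outcome
parityOutcome false = 𝓝
parityOutcome true  = 𝓟

parityOutcome-injective : ∀ {p q} → parityOutcome p ≡ parityOutcome q → p ≡ q
parityOutcome-injective {false} {false} _ = refl
parityOutcome-injective {true}  {true}  _ = refl
parityOutcome-injective {false} {true}  ()
parityOutcome-injective {true}  {false} ()

parityOutcome-𝓝⊎𝓟 : ∀ p → (parityOutcome p ≡ 𝓝) ⊎ (parityOutcome p ≡ 𝓟)
parityOutcome-𝓝⊎𝓟 false = inj₁ refl
parityOutcome-𝓝⊎𝓟 true  = inj₂ refl

outcomeOf-parity : ∀ p → outcomeOf (not p) (not p) ≡ parityOutcome p
outcomeOf-parity false = refl
outcomeOf-parity true  = refl

outcomeOf-parity⁻ : ∀ l r p → outcomeOf l r ≡ parityOutcome p → (l ≡ not p) × (r ≡ not p)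
outcomeOf-parity⁻ true  true  false _  = refl , refl
outcomeOf-parity⁻ false false true  _  = refl , refl
outcomeOf-parity⁻ true  true  true  ()
outcomeOf-parity⁻ false false false ()
outcomeOf-parity⁻ true  false false ()
outcomeOf-parity⁻ true  false true  ()
outcomeOf-parity⁻ false true  false ()
outcomeOf-parity⁻ false true  true  ()

outcome-bits : ∀ {g} p → o⁻ g ≡ parityOutcome p → (leftFirst g ≡ not p) × (rightFirst g ≡ not p)
outcome-bits {g} p = outcomeOf-parity⁻ (leftFirst g) (rightFirst g) p

-- A 𝓟-position has no 𝓟-position among its options: the player to move
-- could move there and win.
𝓟-option : ∀ {g x} → o⁻ g ≡ 𝓟 → x ∈ᴼ g → o⁻ x ≢ 𝓟
𝓟-option {⟨ L ∣ R ⟩} {x} g𝓟 (inj₁ m) x𝓟 =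
  not-¬ (leftFirst-false⁻ {L} {R} (proj₁ (outcome-bits {⟨ L ∣ R ⟩} true g𝓟)) m)
        (proj₂ (outcome-bits {x} true x𝓟))
𝓟-option {⟨ L ∣ R ⟩} {x} g𝓟 (inj₂ m) x𝓟 =
  not-¬ (rightFirst-false⁻ {L} {R} (proj₂ (outcome-bits {⟨ L ∣ R ⟩} true g𝓟)) m)
        (proj₁ (outcome-bits {x} true x𝓟))

data Uniform : Game → Bool → Set where
  uniform : ∀ {L R p} → leftFirst ⟨ L ∣ R ⟩ ≡ not p → rightFirst ⟨ L ∣ R ⟩ ≡ not p
          → (∀ {x} → x ∈ L → Uniform x (not p)) → (∀ {x} → x ∈ R → Uniform x (not p))
          → Uniform ⟨ L ∣ R ⟩ p

leftFirst-bit : ∀ {g p} → Uniform g p → leftFirst g ≡ not p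
leftFirst-bit (uniform l _ _ _) = l

rightFirst-bit : ∀ {g p} → Uniform g p → rightFirst g ≡ not p
rightFirst-bit (uniform _ r _ _) = r

uniform-outcome : ∀ {g p} → Uniform g p → o⁻ g ≡ parityOutcome p
uniform-outcome {p = p} u = trans (cong₂ outcomeOf (leftFirst-bit u) (rightFirst-bit u)) (outcomeOf-parity p)

-- In an odd uniform position both players lose moving first, so both have
-- a move.
uniform-odd-moves : ∀ {L R} → Uniform ⟨ L ∣ R ⟩ true → ∃ (_∈ L) × ∃ (_∈ R)
uniform-odd-moves {[]}              (uniform () _ _ _)
uniform-odd-moves {_ ∷ _} {[]}      (uniform _ () _ _)
uniform-odd-moves {x ∷ _} {y ∷ _} _ = (x , here refl) , (y , here refl)

uniform-intro : ∀ {L R} p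
              → (∀ {x} → x ∈ L → Uniform x (not p)) → (∀ {x} → x ∈ R → Uniform x (not p))
              → (p ≡ true → ∃ (_∈ L) × ∃ (_∈ R)) → Uniform ⟨ L ∣ R ⟩ p
uniform-intro false onL onR _ =
  uniform (leftFirst-true (λ m → rightFirst-bit (onL m)))
          (rightFirst-true (λ m → leftFirst-bit (onR m))) onL onR
uniform-intro true onL onR moves =
  uniform (leftFirst-false (proj₁ (moves refl)) (λ m → rightFirst-bit (onL m)))
          (rightFirst-false (proj₂ (moves refl)) (λ m → leftFirst-bit (onR m))) onL onR

xor-odd : ∀ p q → p xor q ≡ true → (p ≡ true) ⊎ (q ≡ true)
xor-odd true  q _ = inj₁ refl
xor-odd false q e = inj₂ e

uniform-sum : ∀ {g h p q} → Uniform g p → Uniform h q → Uniform (g ⊕ h) (p xor q)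
uniform-sum {⟨ L ∣ R ⟩} {⟨ L' ∣ R' ⟩} {p} {q} ug@(uniform _ _ onL onR) uh@(uniform _ _ onL' onR') =
  uniform-intro (p xor q)
    (sum-options-all (λ m → flipˡ (uniform-sum (onL m) uh)) (λ m → flipʳ (uniform-sum ug (onL' m))))
    (sum-options-all (λ m → flipˡ (uniform-sum (onR m) uh)) (λ m → flipʳ (uniform-sum ug (onR' m))))
    odd-moves
  where
  flipˡ : ∀ {z} → Uniform z (not p xor q) → Uniform z (not (p xor q))
  flipˡ = subst (Uniform _) (sym (not-distribˡ-xor p q))

  flipʳ : ∀ {z} → Uniform z (p xor not q) → Uniform z (not (p xor q))
  flipʳ = subst (Uniform _) (sym (not-distribʳ-xor p q))

  -- an odd summand provides moves for both players in the sum
  odd-moves : p xor q ≡ true → ∃ (_∈ sumˡ L ⟨ L' ∣ R' ⟩ ++ sumʳ ⟨ L ∣ R ⟩ L')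
                             × ∃ (_∈ sumˡ R ⟨ L' ∣ R' ⟩ ++ sumʳ ⟨ L ∣ R ⟩ R')
  odd-moves odd with xor-odd p q odd
  ... | inj₁ p-odd with uniform-odd-moves (subst (Uniform _) p-odd ug)
  ...   | (_ , x∈L) , (_ , y∈R) = (_ , sum-optionˡ L L' _ _ x∈L) , (_ , sum-optionˡ R R' _ _ y∈R)
  odd-moves odd | inj₂ q-odd with uniform-odd-moves (subst (Uniform _) q-odd uh)
  ...   | (_ , x∈L') , (_ , y∈R') = (_ , sum-optionʳ L L' _ _ x∈L') , (_ , sum-optionʳ R R' _ _ y∈R')

zero-uniform : Uniform zeroG false
zero-uniform = uniform refl refl (λ ()) (λ ())

star-uniform : Uniform star true
star-uniform = uniform refl refl zero-option zero-option
  where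
  zero-option : ∀ {x} → x ∈ zeroG ∷ [] → Uniform x false
  zero-option (here refl) = zero-uniform
  zero-option (there ())

cl-star-uniform : ∀ {g} → Cl IsStar g → Σ Bool (Uniform g)
cl-star-uniform (base refl) = true , star-uniform
cl-star-uniform (sum c d) with cl-star-uniform c | cl-star-uniform d
... | p , up | q , uq = p xor q , uniform-sum up uq
cl-star-uniform (optL c m) with cl-star-uniform c
... | p , uniform _ _ onL _ = not p , onL m
cl-star-uniform (optR c m) with cl-star-uniform c
... | p , uniform _ _ _ onR = not p , onR m

zero∈cl-star : Cl IsStar zeroG
zero∈cl-star = optL (base refl) (here refl)

-- Congruent uniform positions of cl(*) have the same parity: compare their
-- outcomes after adding the test position 0.
congruent-parity : ∀ {α β a b} → α ≡[ Cl IsStar ] β → Uniform α a → Uniform β b → a ≡ b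
congruent-parity {α} {β} {a} {b} α≡β ua ub = parityOutcome-injective (begin
  parityOutcome a  ≡⟨ sym (plus-zero-outcome ua) ⟩
  o⁻ (α ⊕ zeroG)   ≡⟨ α≡β zeroG zero∈cl-star ⟩
  o⁻ (β ⊕ zeroG)   ≡⟨ plus-zero-outcome ub ⟩
  parityOutcome b  ∎)
  where
  open ≡-Reasoning
  plus-zero-outcome : ∀ {g p} → Uniform g p → o⁻ (g ⊕ zeroG) ≡ parityOutcome p
  plus-zero-outcome {p = p} u =
    trans (uniform-outcome (uniform-sum u zero-uniform)) (cong parityOutcome (xor-identityʳ p))

module _ {Υ : Game → Set} (par : ∀ {g} → Cl Υ g → Bool)
         (par-outcome : ∀ {g} (c : Cl Υ g) → o⁻ g ≡ parityOutcome (par c))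
         (par-flip : ∀ {g x} (c : Cl Υ g) (cx : Cl Υ x) → x ∈ᴼ g → par cx ≡ not (par c)) where
  mutual
    parity-uniform : ∀ {g} (c : Cl Υ g) → Uniform g (par c)
    parity-uniform {⟨ L ∣ R ⟩} c =
      uniform (proj₁ bits) (proj₂ bits)
        (λ m → subst (Uniform _) (par-flip c (optL c m) (inj₁ m)) (options-uniform L (optL c) m))
        (λ m → subst (Uniform _) (par-flip c (optR c m) (inj₂ m)) (options-uniform R (optR c) m))
      where
      bits : (leftFirst ⟨ L ∣ R ⟩ ≡ not (par c)) × (rightFirst ⟨ L ∣ R ⟩ ≡ not (par c))
      bits = outcome-bits {⟨ L ∣ R ⟩} (par c) (par-outcome c)

    options-uniform : ∀ xs (cl : ∀ {x} → x ∈ xs → Cl Υ x) {x} (m : x ∈ xs) → Uniform x (par (cl m))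
    options-uniform (y ∷ ys) cl (here refl) = parity-uniform (cl (here refl))
    options-uniform (y ∷ ys) cl (there m)   = options-uniform ys (λ m' → cl (there m')) m

module Transfer {Υ : Game → Set} (φ : MisereIso Υ IsStar) where

  parity : ∀ {ξ} → Cl Υ ξ → Bool
  parity {ξ} c = proj₁ (cl-star-uniform (proj₂ (map φ (ξ , c))))

  image-uniform : ∀ {ξ} (c : Cl Υ ξ) → Uniform (proj₁ (map φ (ξ , c))) (parity c)
  image-uniform {ξ} c = proj₂ (cl-star-uniform (proj₂ (map φ (ξ , c))))

  -- φ preserves outcomes, so the parity predicts the outcome
  parity-outcome : ∀ {ξ} (c : Cl Υ ξ) → o⁻ ξ ≡ parityOutcome (parity c)
  parity-outcome {ξ} c = trans (sym (outcome φ (ξ , c))) (uniform-outcome (image-uniform c))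

  -- φ is a homomorphism, so the parity is additive
  parity-sum : ∀ {ξ η} (c : Cl Υ ξ) (d : Cl Υ η) → parity (sum c d) ≡ parity c xor parity d
  parity-sum {ξ} {η} c d =
    congruent-parity (homo φ ξ c η d) (image-uniform (sum c d))
                     (uniform-sum (image-uniform c) (image-uniform d))

  odd : ClElem Υ
  odd = proj₁ (surjective φ (star , base refl))

  odd-parity : parity (proj₂ odd) ≡ true
  odd-parity = congruent-parity (proj₂ (surjective φ (star , base refl)))
                                (image-uniform (proj₂ odd)) star-uniform

  shift-parity : ∀ {ξ} (c : Cl Υ ξ) → parity c ≡ false → parity (sum (proj₂ odd) c) ≡ true
  shift-parity c even = trans (parity-sum (proj₂ odd) c) (cong₂ _xor_ odd-parity even)

  odd-𝓟 : ∀ {ξ} (c : Cl Υ ξ) → parity c ≡ true → o⁻ ξ ≡ 𝓟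
  odd-𝓟 c is-odd = trans (parity-outcome c) (cong parityOutcome is-odd)

  -- An option x of ξ cannot share its parity: if both were odd, ξ and x
  -- would both be 𝓟-positions; if both were even, odd ⊕ ξ and its option
  -- odd ⊕ x would both be.
  parity-flip : ∀ {ξ x} (c : Cl Υ ξ) (cx : Cl Υ x) → x ∈ᴼ ξ → parity cx ≡ not (parity c)
  parity-flip c cx x∈ξ = ¬-not same-parity-impossible
    where
    same-parity-impossible : parity cx ≢ parity c
    same-parity-impossible same with parity c in pc
    ... | true  = 𝓟-option (odd-𝓟 c pc) x∈ξ (odd-𝓟 cx same)
    ... | false = 𝓟-option (odd-𝓟 (sum (proj₂ odd) c) (shift-parity c pc))
                           (sum-translate-option (proj₁ odd) x∈ξ)
                           (odd-𝓟 (sum (proj₂ odd) cx) (shift-parity cx same))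

  cl-uniform : ∀ {ξ} (c : Cl Υ ξ) → Uniform ξ (parity c)
  cl-uniform = parity-uniform parity parity-outcome parity-flip

theorem7p3p3 : (Υ₁ Υ₂ : Game → Set)
    → (φ₁ : MisereIso Υ₁ IsStar) → (φ₂ : MisereIso Υ₂ IsStar)
    → (ξ₁ : Game) (c₁ : Cl Υ₁ ξ₁) (ξ₂ : Game) (c₂ : Cl Υ₂ ξ₂)
    → ((o⁻ (ξ₁ ⊕ ξ₂) ≡ 𝓝) ⊎ (o⁻ (ξ₁ ⊕ ξ₂) ≡ 𝓟))
      × (o⁻ (ξ₁ ⊕ ξ₂) ≡ o⁻ (proj₁ (map φ₁ (ξ₁ , c₁)) ⊕ proj₁ (map φ₂ (ξ₂ , c₂))))
theorem7p3p3 Υ₁ Υ₂ φ₁ φ₂ ξ₁ c₁ ξ₂ c₂ =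
  subst (λ o → (o ≡ 𝓝) ⊎ (o ≡ 𝓟)) (sym sum-outcome) (parityOutcome-𝓝⊎𝓟 p) ,
  trans sum-outcome (sym image-sum-outcome)
  where
  open Transfer using (parity; image-uniform; cl-uniform)

  p : Bool
  p = parity φ₁ c₁ xor parity φ₂ c₂

  sum-outcome : o⁻ (ξ₁ ⊕ ξ₂) ≡ parityOutcome p
  sum-outcome = uniform-outcome (uniform-sum (cl-uniform φ₁ c₁) (cl-uniform φ₂ c₂))

  image-sum-outcome : o⁻ (proj₁ (map φ₁ (ξ₁ , c₁)) ⊕ proj₁ (map φ₂ (ξ₂ , c₂))) ≡ parityOutcome p
  image-sum-outcome = uniform-outcome (uniform-sum (image-uniform φ₁ c₁) (image-uniform φ₂ c₂))
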